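{- Let $l\ge 1$, let $i\in\{0,\ldots,l+1\}$ and $j_1,j_2\in\{0,\ldots,2^l-1\}$ with $\delta(j_1,j_2)>0$, and consider the nodes $v_i(j_1),v_i(j_2)$ of $G_l$. Then: (i) $v_i(j_1)$ and $v_i(j_2)$ have the same degree $d$; (ii) for every port $p\in\{1,\ldots,d\}$, the nodes $\mathrm{next}_p(v_i(j_1))$ and $\mathrm{next}_p(v_i(j_2))$ lie in the same level of $G_l$; (iii) for every port $p\in\{1,\ldots,d\}$, writing these two nodes as $v_{i'}(j_1')$ and $v_{i'}(j_2')$, we have $\delta(j_1',j_2')\geq\delta(j_1,j_2)-1$; (iv) for every port $p\in\{1,\ldots,d\}$, $\mathrm{end}_p(v_i(j_1))=\mathrm{end}_p(v_i(j_2))$.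
   Context: For $j_1,j_2\in\{0,\ldots,2^l-1\}$, $\delta(j_1,j_2)$ is the largest $\delta\in\{0,\ldots,l\}$ with $j_1\equiv j_2\pmod{2^\delta}$. Let $b_k(j)=\lfloor j/2^k\rfloor\bmod 2$ and $\oplus$ bitwise xor. Define $\pi_0(j)=j$ and for $i\ge1$, $\pi_i(j)=(j-2^ib_i(j)-2^{i-1}b_{i-1}(j))+2^ib_{i-1}(j)+2^{i-1}b_i(j)$. The port-labeled graph $G_l$ (every node of degree $k$ has its incident edges labeled bijectively by $\{1,\dots,k\}$; $\lambda(u,v)$ is the port at $u$ of edge $\{u,v\}$) has nodes $v_i(j)$, levels $i\in\{0,\ldots,l+1\}$, columns $j\in\{0,\ldots,2^l-1\}$, and edges: (1) for each $j$, $\{v_0(j),v_0(j\oplus1)\}$ with $\lambda(v_0(j),v_0(j\oplus1))=1+((j+1)\bmod2)$; (2) for each $j$ and $p\in\{1,\ldots,2^l-1\}$, $\{v_{l+1}(j),v_{l+1}((j+p)\bmod2^l)\}$ with $\lambda(v_{l+1}(j),v_{l+1}((j+p)\bmod2^l))=p$; (3) for each $j$ and $i\in\{0,\ldots,l\}$, $\{v_{l+1}(j),v_i(j)\}$ with $\lambda(v_{l+1}(j),v_i(j))=2^l+i$, $\lambda(v_i(j),v_{l+1}(j))=1$ for $i>0$ and $\lambda(v_0(j),v_{l+1}(j))=1+(j\bmod2)$; (4) for each $j$ and $i\in\{0,\ldots,l-1\}$, $\{v_i(j),v_{i+1}(\pi_i(j))\}$ with $\lambda(v_i(j),v_{i+1}(\pi_i(j)))=3$,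 $\lambda(v_{i+1}(\pi_i(j)),v_i(j))=2$. For a node $v$ and port $p\le\deg(v)$, $\mathrm{next}_p(v)$ is the node $u$ with $\lambda(v,u)=p$, and $\mathrm{end}_p(v)=\lambda(\mathrm{next}_p(v),v)$. -}

module Defs where

open import Data.Nat using (ℕ; zero; suc; _+_; _*_; _∸_; _^_; _≤_; _<_; _≡ᵇ_)
open import Data.Nat.DivMod using (_/_; _%_)
open import Data.Nat.Properties using (_≟_; m^n≢0)
open import Data.Bool using (if_then_else_)
open import Data.Product using (_×_; _,_; proj₁)
open import Data.Product.Properties using (≡-dec)
open import Data.List using (List; []; _∷_; map; concatMap; upTo; length; filter; _++_)
open import Data.List.Membership.Propositional using (_∈_)
open import Relation.Binary.PropositionalEquality using (_≡_)
open import Relation.Binary.Definitions using (DecidableEquality)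

_mod2^_ : ℕ → ℕ → ℕ
a mod2^ k = _%_ a (2 ^ k) {{m^n≢0 2 k}}

_div2^_ : ℕ → ℕ → ℕ
a div2^ k = _/_ a (2 ^ k) {{m^n≢0 2 k}}

δ-search : ℕ → ℕ → ℕ → ℕ
δ-search zero    a b = zero
δ-search (suc k) a b =
  if (a mod2^ suc k) ≡ᵇ (b mod2^ suc k) then suc k else δ-search k a b

δ : ℕ → ℕ → ℕ → ℕ
δ l j₁ j₂ = δ-search l j₁ j₂

bit : ℕ → ℕ → ℕ
bit k j = (j div2^ k) % 2

-- j ⊕ 1 (bitwise xor with 1: flips the lowest bit)
xor1 : ℕ → ℕ
xor1 j = (j ∸ (j % 2)) + (1 ∸ (j % 2))

π : ℕ → ℕ → ℕ
π zero    j = j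
π (suc i) j =
  ((j ∸ (2 ^ suc i) * bit (suc i) j ∸ (2 ^ i) * bit i j)
    + (2 ^ suc i) * bit i j) + (2 ^ i) * bit (suc i) j

-- A node v_i(j) is represented as the pair (i , j) : (level , column).
Node : Set
Node = ℕ × ℕ

level : Node → ℕ
level = proj₁

column : Node → ℕ
column (_ , j) = j

-- A half-edge (u , w , p) records an edge {u,w} of G_l with λ(u,w) = p.
HalfEdge : Set
HalfEdge = Node × Node × ℕ

source : HalfEdge → Node
source (u , _ , _) = u

rule1 : ℕ → List HalfEdge
rule1 l = map (λ j → ((0 , j) , (0 , xor1 j) , 1 + ((j + 1) % 2))) (upTo (2 ^ l))

rule2 : ℕ → List HalfEdge
rule2 l = concatMap
  (λ j → map (λ p → ((suc l , j) , (suc l , (j + p) mod2^ l) , p))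
              (map suc (upTo (2 ^ l ∸ 1))))
  (upTo (2 ^ l))

-- port at v_i(j) of the edge to v_{l+1}(j)
portUp : ℕ → ℕ → ℕ
portUp zero    j = 1 + (j % 2)
portUp (suc i) j = 1

rule3 : ℕ → List HalfEdge
rule3 l = concatMap
  (λ j → concatMap
    (λ i → ((suc l , j) , (i , j) , (2 ^ l) + i)
         ∷ ((i , j) , (suc l , j) , portUp i j) ∷ [])
    (upTo (suc l)))
  (upTo (2 ^ l))

rule4 : ℕ → List HalfEdge
rule4 l = concatMap
  (λ j → concatMap
    (λ i → ((i , j) , (suc i , π i j) , 3)
         ∷ ((suc i , π i j) , (i , j) , 2) ∷ [])
    (upTo l))
  (upTo (2 ^ l))

-- all half-edges of G_l (each edge contributes its two half-edges)
halfEdges : ℕ → List HalfEdge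
halfEdges l = rule1 l ++ rule2 l ++ rule3 l ++ rule4 l

_≟N_ : DecidableEquality Node
_≟N_ = ≡-dec _≟_ _≟_

deg : ℕ → Node → ℕ
deg l v = length (filter (λ e → source e ≟N v) (halfEdges l))

Port : ℕ → Node → Node → ℕ → Set
Port l u w p = (u , w , p) ∈ halfEdges l

Next : ℕ → Node → ℕ → Node → Set
Next l v p w = Port l v w p

-- The column j enters the port structure of v_i(j) only through its parity.  Counting the
-- half-edges produced by rules (1)–(4) gives a degree that depends on the level alone, and each
-- port p of a node on level i comes from a single rule, singled out by i, p and (on level 0) the
-- parity of j, which δ(j₁,j₂) > 0 makes equal for the two columns.  That rule also fixes the level
-- of the neighbour and the port back.  The neighbour's column is xor1 j, (j + p) mod 2^l, j or
-- π_i(j); each of these maps numbers agreeing in their k+1 lowest binary digits to numbers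
-- agreeing in their k lowest digits, so δ drops by at most one.
module Submission where

open import Defs
open import Data.Nat
open import Data.Nat.Properties
open import Data.Nat.DivMod
open import Data.Nat.Divisibility using (_∣_; divides)
open import Data.Nat.Tactic.RingSolver using (solve-∀)
open import Data.Bool using (true; false; T)
open import Data.Unit using (tt)
open import Data.Empty using (⊥-elim)
open import Data.Sum using (_⊎_; inj₁; inj₂)
open import Data.Product using (_×_; _,_; proj₁; proj₂; ∃)
open import Data.List using (List; []; _∷_; _++_; map; concatMap; applyUpTo; upTo; length; filter)
open import Data.List.Properties using (filter-++; length-++; length-map; length-upTo)
open import Data.List.Relation.Unary.Any using (here; there)
open import Data.List.Membership.Propositional using (find; lose)
open import Data.List.Membership.Propositional.Properties
open import Function using (_∘_; id)
open import Relation.Nullary using (¬_; Dec; yes; no)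
open import Relation.Binary.Definitions using (tri<; tri≈; tri>)
open import Relation.Binary.PropositionalEquality
open import Algebra.Properties.CommutativeSemigroup +-commutativeSemigroup using (interchange)

-- Binary digits and δ

[r+q*2]%2≡r : ∀ r q → r < 2 → (r + q * 2) % 2 ≡ r
[r+q*2]%2≡r r q r<2 = trans ([m+kn]%n≡m%n r q 2) (m<n⇒m%n≡m r<2)

[r+q*2]/2≡q : ∀ r q → r < 2 → (r + q * 2) / 2 ≡ q
[r+q*2]/2≡q r q r<2 = trans (+-distrib-/-∣ʳ r (divides q refl))
  (cong₂ _+_ (m<n⇒m/n≡0 r<2) (m*n/n≡m q 2))

r+q*2<2^[1+k] : ∀ r q k → r < 2 → q < 2 ^ k → r + q * 2 < 2 ^ suc k
r+q*2<2^[1+k] r q k r<2 q<2^k = begin-strict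
  r + q * 2   <⟨ +-monoˡ-< (q * 2) r<2 ⟩
  suc q * 2   ≤⟨ *-monoˡ-≤ 2 q<2^k ⟩
  2 ^ k * 2   ≡⟨ *-comm (2 ^ k) 2 ⟩
  2 ^ suc k   ∎
  where open ≤-Reasoning

m<2^[1+k]⇒m/2<2^k : ∀ k {m} → m < 2 ^ suc k → m / 2 < 2 ^ k
m<2^[1+k]⇒m/2<2^k k {m} m< = m<n*o⇒m/o<n (subst (m <_) (*-comm 2 (2 ^ k)) m<)

2^k∣2^l : ∀ {k l} → k ≤ l → 2 ^ k ∣ 2 ^ l
2^k∣2^l {k} {l} k≤l = divides (2 ^ (l ∸ k))
  (trans (cong (2 ^_) (sym (m∸n+n≡m k≤l))) (^-distribˡ-+-* 2 (l ∸ k) k))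

mod2^-suc : ∀ k a → a mod2^ suc k ≡ a % 2 + (a / 2) mod2^ k * 2
mod2^-suc k a = begin
  x                       ≡⟨ m≡m%n+[m/n]*n x 2 ⟩
  x % 2 + x / 2 * 2       ≡⟨ cong₂ (λ u v → u + v * 2) low high ⟩
  a % 2 + (a / 2) mod2^ k * 2 ∎
  where
  open ≡-Reasoning
  instance
    2^k≢0 : NonZero (2 ^ k)
    2^k≢0 = m^n≢0 2 k
  x = a mod2^ suc k
  low : x % 2 ≡ a % 2
  low = m∣n⇒o%n%m≡o%m 2 (2 ^ suc k) a {{_}} {{m^n≢0 2 (suc k)}} (divides (2 ^ k) (*-comm 2 (2 ^ k)))
  high : x / 2 ≡ (a / 2) mod2^ k
  high = trans (/-congˡ (%-congʳ {{m^n≢0 2 (suc k)}} {{m*n≢0 (2 ^ k) 2}} (*-comm 2 (2 ^ k))))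
               (m%[n*o]/o≡m/o%n a (2 ^ k) 2 {{_}} {{_}} {{m*n≢0 (2 ^ k) 2}})

infixr 5 _∷_

data Agree : ℕ → ℕ → ℕ → Set where
  []  : ∀ {a b} → Agree 0 a b
  _∷_ : ∀ {k a b} → a % 2 ≡ b % 2 → Agree k (a / 2) (b / 2) → Agree (suc k) a b

Agree-weaken : ∀ k {a b} → Agree (suc k) a b → Agree k a b
Agree-weaken zero    _              = []
Agree-weaken (suc k) (a≡b ∷ rest)   = a≡b ∷ Agree-weaken k rest

Agree-digits : ∀ k {r r′} q q′ → r < 2 → r′ < 2 → r ≡ r′ → Agree k q q′ →
               Agree (suc k) (r + q * 2) (r′ + q′ * 2)
Agree-digits k {r} {r′} q q′ r<2 r′<2 r≡r′ agree =
  trans ([r+q*2]%2≡r r q r<2) (trans r≡r′ (sym ([r+q*2]%2≡r r′ q′ r′<2))) ∷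
  subst₂ (Agree k) (sym ([r+q*2]/2≡q r q r<2)) (sym ([r+q*2]/2≡q r′ q′ r′<2)) agree

Agree⇒mod2^≡ : ∀ k {a b} → Agree k a b → a mod2^ k ≡ b mod2^ k
Agree⇒mod2^≡ zero    {a} {b} _ = trans (n%1≡0 a) (sym (n%1≡0 b))
Agree⇒mod2^≡ (suc k) {a} {b} (a≡b ∷ rest) = begin
  a mod2^ suc k                 ≡⟨ mod2^-suc k a ⟩
  a % 2 + (a / 2) mod2^ k * 2   ≡⟨ cong₂ (λ u v → u + v * 2) a≡b (Agree⇒mod2^≡ k rest) ⟩
  b % 2 + (b / 2) mod2^ k * 2   ≡⟨ mod2^-suc k b ⟨
  b mod2^ suc k                 ∎
  where open ≡-Reasoning

mod2^≡⇒Agree : ∀ k {a b} → a mod2^ k ≡ b mod2^ k → Agree k a b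
mod2^≡⇒Agree zero    _   = []
mod2^≡⇒Agree (suc k) {a} {b} a≡b =
  trans (sym (low a)) (trans (cong (_% 2) split≡) (low b)) ∷
  mod2^≡⇒Agree k (trans (sym (high a)) (trans (cong (_/ 2) split≡) (high b)))
  where
  split≡ : a % 2 + (a / 2) mod2^ k * 2 ≡ b % 2 + (b / 2) mod2^ k * 2
  split≡ = trans (sym (mod2^-suc k a)) (trans a≡b (mod2^-suc k b))
  low : ∀ x → (x % 2 + (x / 2) mod2^ k * 2) % 2 ≡ x % 2
  low x = [r+q*2]%2≡r (x % 2) ((x / 2) mod2^ k) (m%n<n x 2)
  high : ∀ x → (x % 2 + (x / 2) mod2^ k * 2) / 2 ≡ (x / 2) mod2^ k
  high x = [r+q*2]/2≡q (x % 2) ((x / 2) mod2^ k) (m%n<n x 2)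

δ-search-sound : ∀ m a b {k} → δ-search m a b ≡ suc k → Agree (suc k) a b
δ-search-sound zero    a b ()
δ-search-sound (suc m) a b e with (a mod2^ suc m) ≡ᵇ (b mod2^ suc m) in eq
... | true  = subst (λ k → Agree k a b) e (mod2^≡⇒Agree (suc m) (≡ᵇ⇒≡ _ _ (subst T (sym eq) tt)))
... | false = δ-search-sound m a b e

δ-search≤ : ∀ m a b → δ-search m a b ≤ m
δ-search≤ zero    a b = z≤n
δ-search≤ (suc m) a b with (a mod2^ suc m) ≡ᵇ (b mod2^ suc m)
... | true  = ≤-refl
... | false = m≤n⇒m≤1+n (δ-search≤ m a b)

δ-search-complete : ∀ m a b {k} → k ≤ m → Agree k a b → k ≤ δ-search m a b
δ-search-complete zero    a b k≤m _ = k≤m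
δ-search-complete (suc m) a b k≤m agree with (a mod2^ suc m) ≡ᵇ (b mod2^ suc m) in eq
... | true  = k≤m
... | false with m≤n⇒m<n∨m≡n k≤m
...   | inj₁ (s≤s k≤m′) = δ-search-complete m a b k≤m′ agree
...   | inj₂ refl = ⊥-elim (subst T eq (≡⇒≡ᵇ _ _ (Agree⇒mod2^≡ (suc m) {a} {b} agree)))

δ≤δ+1 : ∀ l {j₁ j₂ c₁ c₂} → (∀ k → suc k ≤ l → Agree (suc k) j₁ j₂ → Agree k c₁ c₂) →
        δ l j₁ j₂ ≤ δ l c₁ c₂ + 1
δ≤δ+1 l {j₁} {j₂} {c₁} {c₂} transfer with δ-search l j₁ j₂ in eq
... | zero  = z≤n
... | suc k = subst (suc k ≤_) (+-comm 1 (δ l c₁ c₂))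
  (s≤s (δ-search-complete l c₁ c₂ (<⇒≤ k<l) (transfer k k<l (δ-search-sound l j₁ j₂ eq))))
  where
  k<l : suc k ≤ l
  k<l = subst (_≤ l) eq (δ-search≤ l j₁ j₂)

0<δ⇒%2≡ : ∀ l {a b} → 0 < δ l a b → a % 2 ≡ b % 2
0<δ⇒%2≡ l {a} {b} 0<δ with δ-search l a b in eq
... | suc k with a≡b ∷ _ ← δ-search-sound l a b eq = a≡b

-- The permutations π_i

bit-zero : ∀ j → bit 0 j ≡ j % 2
bit-zero j = cong (_% 2) (n/1≡n j)

bit-suc : ∀ k j → bit (suc k) j ≡ bit k (j / 2)
bit-suc k j = cong (_% 2) (sym (m/n/o≡m/[n*o] j 2 (2 ^ k) {{_}} {{m^n≢0 2 k}} {{m^n≢0 2 (suc k)}}))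

m+n+o∸o∸n≡m : ∀ m n o → (m + n) + o ∸ o ∸ n ≡ m
m+n+o∸o∸n≡m m n o = trans (cong (_∸ n) (m+n∸n≡m (m + n) o)) (m+n∸n≡m m n)

bit-pair≤ : ∀ i j → 2 ^ suc i * bit (suc i) j + 2 ^ i * bit i j ≤ j
bit-pair≤ zero j rewrite bit-suc 0 j | bit-zero (j / 2) | bit-zero j = begin
  2 * 1 * ((j / 2) % 2) + 1 * (j % 2) ≡⟨ reorder ((j / 2) % 2) (j % 2) ⟩
  j % 2 + ((j / 2) % 2) * 2           ≤⟨ +-monoʳ-≤ (j % 2) (*-monoˡ-≤ 2 (m%n≤m (j / 2) 2)) ⟩
  j % 2 + (j / 2) * 2                 ≡⟨ m≡m%n+[m/n]*n j 2 ⟨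
  j                                   ∎
  where
  open ≤-Reasoning
  reorder : ∀ x y → 2 * 1 * x + 1 * y ≡ y + x * 2
  reorder = solve-∀
bit-pair≤ (suc i) j rewrite bit-suc (suc i) j | bit-suc i j = begin
  2 * P * B + 2 * Q * b ≡⟨ factor P B Q b ⟩
  (P * B + Q * b) * 2   ≤⟨ *-monoˡ-≤ 2 (bit-pair≤ i (j / 2)) ⟩
  (j / 2) * 2           ≤⟨ m≤n+m ((j / 2) * 2) (j % 2) ⟩
  j % 2 + (j / 2) * 2   ≡⟨ m≡m%n+[m/n]*n j 2 ⟨
  j                     ∎
  where
  open ≤-Reasoning
  P = 2 ^ suc i
  Q = 2 ^ i
  B = bit (suc i) (j / 2)
  b = bit i (j / 2)
  factor : ∀ P B Q b → 2 * P * B + 2 * Q * b ≡ (P * B + Q * b) * 2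
  factor = solve-∀

π-suc-suc : ∀ i j → π (suc (suc i)) j ≡ j % 2 + π (suc i) (j / 2) * 2
π-suc-suc i j = begin
  π (suc (suc i)) j
    ≡⟨ cong₂ (λ x y → ((j ∸ 2 * P * x ∸ 2 * Q * y) + 2 * P * y) + 2 * Q * x)
             (bit-suc (suc i) j) (bit-suc i j) ⟩
  ((j ∸ 2 * P * B ∸ 2 * Q * b) + 2 * P * b) + 2 * Q * B
    ≡⟨ cong (λ x → ((x ∸ 2 * P * B ∸ 2 * Q * b) + 2 * P * b) + 2 * Q * B) j-split ⟩
  ((((r + t * 2) + 2 * Q * b) + 2 * P * B ∸ 2 * P * B ∸ 2 * Q * b) + 2 * P * b) + 2 * Q * B
    ≡⟨ cong (λ x → (x + 2 * P * b) + 2 * Q * B) (m+n+o∸o∸n≡m (r + t * 2) (2 * Q * b) (2 * P * B)) ⟩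
  ((r + t * 2) + 2 * P * b) + 2 * Q * B
    ≡⟨ regroup r t P b Q B ⟩
  r + ((t + P * b) + Q * B) * 2 ∎
  where
  open ≡-Reasoning
  P = 2 ^ suc i
  Q = 2 ^ i
  r = j % 2
  B = bit (suc i) (j / 2)
  b = bit i (j / 2)
  t = j / 2 ∸ P * B ∸ Q * b
  half-split : j / 2 ≡ t + (P * B + Q * b)
  half-split = sym (trans (cong (_+ (P * B + Q * b)) (∸-+-assoc (j / 2) (P * B) (Q * b)))
                          (m∸n+n≡m (bit-pair≤ i (j / 2))))
  spread : ∀ r t P B Q b → r + (t + (P * B + Q * b)) * 2 ≡ ((r + t * 2) + 2 * Q * b) + 2 * P * B
  spread = solve-∀
  j-split : j ≡ ((r + t * 2) + 2 * Q * b) + 2 * P * B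
  j-split = trans (m≡m%n+[m/n]*n j 2) (trans (cong (λ x → r + x * 2) half-split) (spread r t P B Q b))
  regroup : ∀ r t P b Q B → ((r + t * 2) + 2 * P * b) + 2 * Q * B ≡ r + ((t + P * b) + Q * B) * 2
  regroup = solve-∀

π-1 : ∀ j → π 1 j ≡ (j / 2) % 2 + (j % 2 + (j / 2 / 2) * 2) * 2
π-1 j = begin
  π 1 j
    ≡⟨ cong₂ (λ x y → ((j ∸ 2 * x ∸ 1 * y) + 2 * y) + 1 * x)
             (trans (bit-suc 0 j) (bit-zero (j / 2))) (bit-zero j) ⟩
  ((j ∸ 2 * r′ ∸ 1 * r) + 2 * r) + 1 * r′
    ≡⟨ cong (λ x → ((x ∸ 2 * r′ ∸ 1 * r) + 2 * r) + 1 * r′) j-split ⟩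
  (((q′ * 4 + 1 * r) + 2 * r′ ∸ 2 * r′ ∸ 1 * r) + 2 * r) + 1 * r′
    ≡⟨ cong (λ x → (x + 2 * r) + 1 * r′) (m+n+o∸o∸n≡m (q′ * 4) (1 * r) (2 * r′)) ⟩
  (q′ * 4 + 2 * r) + 1 * r′
    ≡⟨ regroup q′ r r′ ⟩
  r′ + (r + q′ * 2) * 2 ∎
  where
  open ≡-Reasoning
  r = j % 2
  r′ = (j / 2) % 2
  q′ = j / 2 / 2
  spread : ∀ r r′ q′ → r + (r′ + q′ * 2) * 2 ≡ (q′ * 4 + 1 * r) + 2 * r′
  spread = solve-∀
  j-split : j ≡ (q′ * 4 + 1 * r) + 2 * r′
  j-split = trans (m≡m%n+[m/n]*n j 2)
                  (trans (cong (λ x → r + x * 2) (m≡m%n+[m/n]*n (j / 2) 2)) (spread r r′ q′))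
  regroup : ∀ q′ r r′ → (q′ * 4 + 2 * r) + 1 * r′ ≡ r′ + (r + q′ * 2) * 2
  regroup = solve-∀

π-Agree : ∀ i k {a b} → Agree (suc k) a b → Agree k (π i a) (π i b)
π-Agree zero          k       agree = Agree-weaken k agree
π-Agree (suc zero)    zero    _     = []
π-Agree (suc zero)    (suc k) {a} {b} (bit0≡ ∷ bit1≡ ∷ rest) =
  subst₂ (Agree (suc k)) (sym (π-1 a)) (sym (π-1 b))
    (Agree-digits k _ _ (m%n<n (a / 2) 2) (m%n<n (b / 2) 2) bit1≡ (swapped k rest))
  where
  swapped : ∀ k → Agree k (a / 2 / 2) (b / 2 / 2) →
            Agree k (a % 2 + (a / 2 / 2) * 2) (b % 2 + (b / 2 / 2) * 2)
  swapped zero    _     = []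
  swapped (suc k) agree =
    Agree-digits k (a / 2 / 2) (b / 2 / 2) (m%n<n a 2) (m%n<n b 2) bit0≡ (Agree-weaken k agree)
π-Agree (suc (suc i)) zero    _     = []
π-Agree (suc (suc i)) (suc k) {a} {b} (bit0≡ ∷ rest) =
  subst₂ (Agree (suc k)) (sym (π-suc-suc i a)) (sym (π-suc-suc i b))
    (Agree-digits k (π (suc i) (a / 2)) (π (suc i) (b / 2)) (m%n<n a 2) (m%n<n b 2) bit0≡
                  (π-Agree (suc i) k rest))

π-involutive : ∀ i j → π i (π i j) ≡ j
π-involutive zero          j = refl
π-involutive (suc zero)    j = begin
  π 1 (π 1 j)                                   ≡⟨ cong (π 1) (π-1 j) ⟩
  π 1 x                                         ≡⟨ π-1 x ⟩
  (x / 2) % 2 + (x % 2 + (x / 2 / 2) * 2) * 2   ≡⟨ cong₂ (λ u v → u % 2 + (v + (u / 2) * 2) * 2) x/2≡ x%2≡ ⟩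
  y % 2 + (r′ + (y / 2) * 2) * 2                ≡⟨ cong₂ (λ u v → u + (r′ + v * 2) * 2) ([r+q*2]%2≡r r q′ (m%n<n j 2))
                                                                                        ([r+q*2]/2≡q r q′ (m%n<n j 2)) ⟩
  r + (r′ + q′ * 2) * 2                         ≡⟨ cong (λ v → r + v * 2) (m≡m%n+[m/n]*n (j / 2) 2) ⟨
  r + (j / 2) * 2                               ≡⟨ m≡m%n+[m/n]*n j 2 ⟨
  j                                             ∎
  where
  open ≡-Reasoning
  r = j % 2
  r′ = (j / 2) % 2
  q′ = j / 2 / 2
  y = r + q′ * 2
  x = r′ + y * 2
  x%2≡ : x % 2 ≡ r′
  x%2≡ = [r+q*2]%2≡r r′ y (m%n<n (j / 2) 2)
  x/2≡ : x / 2 ≡ y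
  x/2≡ = [r+q*2]/2≡q r′ y (m%n<n (j / 2) 2)
π-involutive (suc (suc i)) j = begin
  π (suc (suc i)) (π (suc (suc i)) j)   ≡⟨ cong (π (suc (suc i))) (π-suc-suc i j) ⟩
  π (suc (suc i)) x                     ≡⟨ π-suc-suc i x ⟩
  x % 2 + π (suc i) (x / 2) * 2         ≡⟨ cong₂ (λ u v → u + π (suc i) v * 2) ([r+q*2]%2≡r (j % 2) y (m%n<n j 2))
                                                                             ([r+q*2]/2≡q (j % 2) y (m%n<n j 2)) ⟩
  j % 2 + π (suc i) (π (suc i) (j / 2)) * 2 ≡⟨ cong (λ v → j % 2 + v * 2) (π-involutive (suc i) (j / 2)) ⟩
  j % 2 + (j / 2) * 2                   ≡⟨ m≡m%n+[m/n]*n j 2 ⟨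
  j                                     ∎
  where
  open ≡-Reasoning
  y = π (suc i) (j / 2)
  x = j % 2 + y * 2

π-< : ∀ {i l j} → i < l → j < 2 ^ l → π i j < 2 ^ l
π-< {zero}                             _         j<2^l = j<2^l
π-< {suc zero}    {suc zero}           (s≤s ())  _
π-< {suc zero}    {suc (suc l)} {j}    _         j<2^l =
  subst (_< 2 ^ suc (suc l)) (sym (π-1 j))
    (r+q*2<2^[1+k] _ _ (suc l) (m%n<n (j / 2) 2)
      (r+q*2<2^[1+k] _ _ l (m%n<n j 2) (m<2^[1+k]⇒m/2<2^k l (m<2^[1+k]⇒m/2<2^k (suc l) j<2^l))))
π-< {suc (suc i)} {suc l}       {j}    (s≤s i<l) j<2^l =
  subst (_< 2 ^ suc l) (sym (π-suc-suc i j))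
    (r+q*2<2^[1+k] _ _ l (m%n<n j 2) (π-< i<l (m<2^[1+k]⇒m/2<2^k l j<2^l)))

1∸r<2 : ∀ r → 1 ∸ r < 2
1∸r<2 r = s≤s (m∸n≤m 1 r)

xor1-split : ∀ j → xor1 j ≡ (1 ∸ j % 2) + (j / 2) * 2
xor1-split j = trans (cong (_+ (1 ∸ j % 2)) j∸r≡) (+-comm ((j / 2) * 2) (1 ∸ j % 2))
  where
  j∸r≡ : j ∸ j % 2 ≡ (j / 2) * 2
  j∸r≡ = trans (cong (_∸ j % 2) (m≡m%n+[m/n]*n j 2)) (m+n∸m≡n (j % 2) ((j / 2) * 2))

xor1-%2 : ∀ j → xor1 j % 2 ≡ 1 ∸ j % 2
xor1-%2 j = trans (cong (_% 2) (xor1-split j)) ([r+q*2]%2≡r (1 ∸ j % 2) (j / 2) (1∸r<2 (j % 2)))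

xor1-/2 : ∀ j → xor1 j / 2 ≡ j / 2
xor1-/2 j = trans (cong (_/ 2) (xor1-split j)) ([r+q*2]/2≡q (1 ∸ j % 2) (j / 2) (1∸r<2 (j % 2)))

xor1-Agree : ∀ k {a b} → Agree (suc k) a b → Agree (suc k) (xor1 a) (xor1 b)
xor1-Agree k {a} {b} (a≡b ∷ rest) =
  trans (xor1-%2 a) (trans (cong (1 ∸_) a≡b) (sym (xor1-%2 b))) ∷
  subst₂ (Agree k) (sym (xor1-/2 a)) (sym (xor1-/2 b)) rest

xor1-involutive : ∀ j → xor1 (xor1 j) ≡ j
xor1-involutive j = begin
  xor1 (xor1 j)                            ≡⟨ xor1-split (xor1 j) ⟩
  (1 ∸ xor1 j % 2) + (xor1 j / 2) * 2      ≡⟨ cong₂ (λ a b → (1 ∸ a) + b * 2) (xor1-%2 j) (xor1-/2 j) ⟩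
  (1 ∸ (1 ∸ j % 2)) + (j / 2) * 2          ≡⟨ cong (_+ (j / 2) * 2) (m∸[m∸n]≡n (≤-pred (m%n<n j 2))) ⟩
  j % 2 + (j / 2) * 2                      ≡⟨ m≡m%n+[m/n]*n j 2 ⟨
  j                                        ∎
  where open ≡-Reasoning

xor1-< : ∀ {l j} → 1 ≤ l → j < 2 ^ l → xor1 j < 2 ^ l
xor1-< {suc l} {j} _ j<2^l = subst (_< 2 ^ suc l) (sym (xor1-split j))
  (r+q*2<2^[1+k] _ (j / 2) l (1∸r<2 (j % 2)) (m<2^[1+k]⇒m/2<2^k l j<2^l))

[j+1]%2≡1∸j%2 : ∀ j → (j + 1) % 2 ≡ 1 ∸ j % 2
[j+1]%2≡1∸j%2 j = trans (%-distribˡ-+ j 1 2) (flip (j % 2) (m%n<n j 2))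
  where
  flip : ∀ r → r < 2 → (r + 1) % 2 ≡ 1 ∸ r
  flip zero          _ = refl
  flip (suc zero)    _ = refl
  flip (suc (suc r)) (s≤s (s≤s ()))

+-mod2^-Agree : ∀ {k l j₁ j₂} p → suc k ≤ l → Agree (suc k) j₁ j₂ →
                Agree k ((j₁ + p) mod2^ l) ((j₂ + p) mod2^ l)
+-mod2^-Agree {k} {l} {j₁} {j₂} p k<l agree = mod2^≡⇒Agree k (begin
  ((j₁ + p) mod2^ l) mod2^ k         ≡⟨ drop-outer (j₁ + p) ⟩
  (j₁ + p) mod2^ k                   ≡⟨ %-distribˡ-+ j₁ p (2 ^ k) ⟩
  (j₁ mod2^ k + p mod2^ k) mod2^ k   ≡⟨ cong (λ x → (x + p mod2^ k) mod2^ k) (Agree⇒mod2^≡ k (Agree-weaken k agree)) ⟩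
  (j₂ mod2^ k + p mod2^ k) mod2^ k   ≡⟨ %-distribˡ-+ j₂ p (2 ^ k) ⟨
  (j₂ + p) mod2^ k                   ≡⟨ drop-outer (j₂ + p) ⟨
  ((j₂ + p) mod2^ l) mod2^ k         ∎)
  where
  open ≡-Reasoning
  instance
    2^k≢0 : NonZero (2 ^ k)
    2^k≢0 = m^n≢0 2 k
    2^l≢0 : NonZero (2 ^ l)
    2^l≢0 = m^n≢0 2 l
  drop-outer : ∀ x → (x mod2^ l) mod2^ k ≡ x mod2^ k
  drop-outer x = m∣n⇒o%n%m≡o%m (2 ^ k) (2 ^ l) x (2^k∣2^l (<⇒≤ k<l))

module Rotation (n : ℕ) .{{_ : NonZero n}} where

  [m+d]%n≡m%n⇒d≡0 : ∀ m {d} → d < n → (m + d) % n ≡ m % n → d ≡ 0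
  [m+d]%n≡m%n⇒d≡0 m {d} d<n eq with (m + d) / n ∸ m / n | d≡k*n
    where
    d≡k*n : d ≡ ((m + d) / n ∸ m / n) * n
    d≡k*n = begin
      d
        ≡⟨ m+n∸m≡n m d ⟨
      (m + d) ∸ m
        ≡⟨ cong₂ _∸_ (m≡m%n+[m/n]*n (m + d) n) (m≡m%n+[m/n]*n m n) ⟩
      ((m + d) % n + (m + d) / n * n) ∸ (m % n + m / n * n)
        ≡⟨ cong (λ x → (x + (m + d) / n * n) ∸ (m % n + m / n * n)) eq ⟩
      (m % n + (m + d) / n * n) ∸ (m % n + m / n * n)
        ≡⟨ [m+n]∸[m+o]≡n∸o (m % n) _ _ ⟩
      (m + d) / n * n ∸ m / n * n
        ≡⟨ *-distribʳ-∸ n ((m + d) / n) (m / n) ⟨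
      ((m + d) / n ∸ m / n) * n
        ∎
      where open ≡-Reasoning
  ... | zero  | d≡0     = d≡0
  ... | suc k | d≡n+k*n = ⊥-elim (<⇒≱ d<n (subst (n ≤_) (sym d≡n+k*n) (m≤m+n n (k * n))))

  +-%-injective-≤ : ∀ c {x y} → x ≤ y → y < n → (c + x) % n ≡ (c + y) % n → y ≡ x
  +-%-injective-≤ c {x} {y} x≤y y<n eq = begin
    y             ≡⟨ m∸n+n≡m x≤y ⟨
    (y ∸ x) + x   ≡⟨ cong (_+ x) gap≡0 ⟩
    x             ∎
    where
    open ≡-Reasoning
    gap≡0 : y ∸ x ≡ 0
    gap≡0 = [m+d]%n≡m%n⇒d≡0 (c + x) (≤-<-trans (m∸n≤m y x) y<n)
      (trans (cong (_% n) (trans (+-assoc c x (y ∸ x)) (cong (c +_) (m+[n∸m]≡n x≤y)))) (sym eq))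

  +-%-injectiveʳ : ∀ c {q q′} → q < n → q′ < n → (c + q) % n ≡ (c + q′) % n → q ≡ q′
  +-%-injectiveʳ c {q} {q′} q<n q′<n eq with ≤-total q q′
  ... | inj₁ q≤q′ = sym (+-%-injective-≤ c q≤q′ q′<n eq)
  ... | inj₂ q′≤q = +-%-injective-≤ c q′≤q q<n (sym eq)

  [m%n+o]%n≡[m+o]%n : ∀ m o → (m % n + o) % n ≡ (m + o) % n
  [m%n+o]%n≡[m+o]%n m o = begin
    (m % n + o) % n           ≡⟨ %-distribˡ-+ (m % n) o n ⟩
    (m % n % n + o % n) % n   ≡⟨ cong (λ x → (x + o % n) % n) (m%n%n≡m%n m n) ⟩
    (m % n + o % n) % n       ≡⟨ %-distribˡ-+ m o n ⟨
    (m + o) % n               ∎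
    where open ≡-Reasoning

  rotate-back : ∀ {j p} → j < n → p ≤ n → ((j + p) % n + (n ∸ p)) % n ≡ j
  rotate-back {j} {p} j<n p≤n = begin
    ((j + p) % n + (n ∸ p)) % n   ≡⟨ [m%n+o]%n≡[m+o]%n (j + p) (n ∸ p) ⟩
    (j + p + (n ∸ p)) % n         ≡⟨ cong (_% n) (trans (+-assoc j p (n ∸ p)) (cong (j +_) (m+[n∸m]≡n p≤n))) ⟩
    (j + n) % n                   ≡⟨ [m+n]%n≡m%n j n ⟩
    j % n                         ≡⟨ m<n⇒m%n≡m j<n ⟩
    j                             ∎
    where open ≡-Reasoning

  rotate-back-unique : ∀ {j p q} → j < n → 0 < p → p ≤ n → q < n →
                       ((j + p) % n + q) % n ≡ j → q ≡ n ∸ p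
  rotate-back-unique {j} {p} {q} j<n 0<p p≤n q<n back =
    +-%-injectiveʳ ((j + p) % n) q<n (∸-monoʳ-< 0<p p≤n) (trans back (sym (rotate-back j<n p≤n)))

-- Finite sums and counting

𝟙 : ∀ {P : Set} → Dec P → ℕ
𝟙 (yes _) = 1
𝟙 (no  _) = 0

𝟙-yes : ∀ {P : Set} (P? : Dec P) → P → 𝟙 P? ≡ 1
𝟙-yes (yes _) _ = refl
𝟙-yes (no ¬p) p = ⊥-elim (¬p p)

𝟙-no : ∀ {P : Set} (P? : Dec P) → ¬ P → 𝟙 P? ≡ 0
𝟙-no (yes p) ¬p = ⊥-elim (¬p p)
𝟙-no (no _)  _  = refl

𝟙-≟N : ∀ a b c d → 𝟙 ((a , b) ≟N (c , d)) ≡ 𝟙 (a ≟ c) * 𝟙 (b ≟ d)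
𝟙-≟N a b c d = split (a ≟ c) (b ≟ d) ((a , b) ≟N (c , d))
  where
  split : (a≟c : Dec (a ≡ c)) (b≟d : Dec (b ≡ d)) (ab≟cd : Dec ((a , b) ≡ (c , d))) →
          𝟙 ab≟cd ≡ 𝟙 a≟c * 𝟙 b≟d
  split (yes refl) (yes refl) ab≟cd = 𝟙-yes ab≟cd refl
  split (yes _)    (no b≢d)   ab≟cd = 𝟙-no ab≟cd (b≢d ∘ cong proj₂)
  split (no a≢c)   _          ab≟cd = 𝟙-no ab≟cd (a≢c ∘ cong proj₁)

𝟙-suc : ∀ a b → 𝟙 (suc a ≟ suc b) ≡ 𝟙 (a ≟ b)
𝟙-suc a b = shift (a ≟ b) (suc a ≟ suc b)
  where
  shift : (a≟b : Dec (a ≡ b)) (sa≟sb : Dec (suc a ≡ suc b)) → 𝟙 sa≟sb ≡ 𝟙 a≟b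
  shift (yes a≡b) sa≟sb = 𝟙-yes sa≟sb (cong suc a≡b)
  shift (no a≢b)  sa≟sb = 𝟙-no sa≟sb (a≢b ∘ suc-injective)

∑ : ℕ → (ℕ → ℕ) → ℕ
∑ zero    f = 0
∑ (suc n) f = f 0 + ∑ n (f ∘ suc)

infixr 5 ∑
syntax ∑ n (λ i → e) = ∑[ i < n ] e

∑-cong : ∀ n {f g} → (∀ k → k < n → f k ≡ g k) → ∑ n f ≡ ∑ n g
∑-cong zero    _  = refl
∑-cong (suc n) f≡g = cong₂ _+_ (f≡g 0 z<s) (∑-cong n (λ k k<n → f≡g (suc k) (s≤s k<n)))

∑-zero : ∀ n {f} → (∀ k → k < n → f k ≡ 0) → ∑ n f ≡ 0
∑-zero zero    _  = refl
∑-zero (suc n) f≡0 = cong₂ _+_ (f≡0 0 z<s) (∑-zero n (λ k k<n → f≡0 (suc k) (s≤s k<n)))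

∑-single : ∀ n {f k₀} → k₀ < n → (∀ k → k < n → k ≢ k₀ → f k ≡ 0) → ∑ n f ≡ f k₀
∑-single (suc n) {f} {zero}   _          f≡0 =
  trans (cong (f 0 +_) (∑-zero n (λ k k<n → f≡0 (suc k) (s≤s k<n) λ ()))) (+-identityʳ (f 0))
∑-single (suc n) {f} {suc k₀} (s≤s k₀<n) f≡0 =
  cong₂ _+_ (f≡0 0 z<s λ ()) (∑-single n k₀<n (λ k k<n k≢k₀ → f≡0 (suc k) (s≤s k<n) (k≢k₀ ∘ suc-injective)))

∑-+ : ∀ n f g → ∑[ k < n ] (f k + g k) ≡ ∑ n f + ∑ n g
∑-+ zero    f g = refl
∑-+ (suc n) f g = trans (cong (f 0 + g 0 +_) (∑-+ n (f ∘ suc) (g ∘ suc)))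
                        (interchange (f 0) (g 0) (∑ n (f ∘ suc)) (∑ n (g ∘ suc)))

∑-comm : ∀ n m (g : ℕ → ℕ → ℕ) → ∑[ a < n ] ∑[ b < m ] g a b ≡ ∑[ b < m ] ∑[ a < n ] g a b
∑-comm zero    m g = sym (∑-zero m (λ _ _ → refl))
∑-comm (suc n) m g = trans (cong (∑ m (g 0) +_) (∑-comm n m (g ∘ suc)))
                           (sym (∑-+ m (g 0) (λ b → ∑[ a < n ] g (suc a) b)))

∑-one : ∀ n → ∑[ i < n ] 1 ≡ n
∑-one zero    = refl
∑-one (suc n) = cong suc (∑-one n)

∑-𝟙-< : ∀ n {I} → I < n → ∑[ i < n ] 𝟙 (i ≟ I) ≡ 1
∑-𝟙-< n {I} I<n = trans (∑-single n I<n (λ k _ k≢I → 𝟙-no (k ≟ I) k≢I)) (𝟙-yes (I ≟ I) refl)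

∑-𝟙-≥ : ∀ n {I} → n ≤ I → ∑[ i < n ] 𝟙 (i ≟ I) ≡ 0
∑-𝟙-≥ n {I} n≤I = ∑-zero n (λ k k<n → 𝟙-no (k ≟ I) (λ k≡I → <⇒≱ k<n (subst (n ≤_) (sym k≡I) n≤I)))

∑-𝟙-involution : ∀ n (σ : ℕ → ℕ) c {J} → (∀ k → σ (σ k) ≡ k) → σ J < n →
                 ∑[ k < n ] c * 𝟙 (σ k ≟ J) ≡ c
∑-𝟙-involution n σ c {J} σ-inv σJ<n = begin
  ∑[ k < n ] c * 𝟙 (σ k ≟ J)  ≡⟨ ∑-single n σJ<n vanish ⟩
  c * 𝟙 (σ (σ J) ≟ J)        ≡⟨ cong (c *_) (𝟙-yes (σ (σ J) ≟ J) (σ-inv J)) ⟩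
  c * 1                       ≡⟨ *-identityʳ c ⟩
  c                           ∎
  where
  open ≡-Reasoning
  vanish : ∀ k → k < n → k ≢ σ J → c * 𝟙 (σ k ≟ J) ≡ 0
  vanish k _ k≢σJ = trans (cong (c *_) (𝟙-no (σ k ≟ J) (λ σk≡J → k≢σJ (trans (sym (σ-inv k)) (cong σ σk≡J)))))
                          (*-zeroʳ c)

count : Node → List HalfEdge → ℕ
count v xs = length (filter (λ e → source e ≟N v) xs)

count-∷ : ∀ v e xs → count v (e ∷ xs) ≡ 𝟙 (source e ≟N v) + count v xs
count-∷ v e xs with source e ≟N v
... | yes _ = refl
... | no  _ = refl

count-++ : ∀ v xs ys → count v (xs ++ ys) ≡ count v xs + count v ys
count-++ v xs ys = trans (cong length (filter-++ (λ e → source e ≟N v) xs ys)) (length-++ (filter _ xs))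

count-concatMap : ∀ v (f : ℕ → List HalfEdge) g n →
                  count v (concatMap f (applyUpTo g n)) ≡ ∑[ k < n ] count v (f (g k))
count-concatMap v f g zero    = refl
count-concatMap v f g (suc n) =
  trans (count-++ v (f (g 0)) _) (cong (count v (f (g 0)) +_) (count-concatMap v f (g ∘ suc) n))

count-map : ∀ v (f : ℕ → HalfEdge) g n →
            count v (map f (applyUpTo g n)) ≡ ∑[ k < n ] 𝟙 (source (f (g k)) ≟N v)
count-map v f g zero    = refl
count-map v f g (suc n) = trans (count-∷ v (f (g 0)) _) (cong (_ +_) (count-map v f (g ∘ suc) n))

count-map-from : ∀ v u (f : ℕ → HalfEdge) xs → (∀ x → source (f x) ≡ u) →
                 count v (map f xs) ≡ 𝟙 (u ≟N v) * length xs
count-map-from v u f []       _       = sym (*-zeroʳ (𝟙 (u ≟N v)))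
count-map-from v u f (x ∷ xs) from-u = begin
  count v (f x ∷ map f xs)                        ≡⟨ count-∷ v (f x) (map f xs) ⟩
  𝟙 (source (f x) ≟N v) + count v (map f xs)     ≡⟨ cong₂ _+_ (cong (λ s → 𝟙 (s ≟N v)) (from-u x)) (count-map-from v u f xs from-u) ⟩
  𝟙 (u ≟N v) + 𝟙 (u ≟N v) * length xs           ≡⟨ *-suc (𝟙 (u ≟N v)) (length xs) ⟨
  𝟙 (u ≟N v) * length (x ∷ xs)                   ∎
  where open ≡-Reasoning

-- One constructor per clause of rules (1)–(4) producing a half-edge at v_I(J); the side
-- conditions are equations, so that matching never has to unify non-constructor terms.
data Link (l I J : ℕ) (w : Node) (p : ℕ) : Set where
  xor-link  : I ≡ 0 → J < 2 ^ l → w ≡ (0 , xor1 J) → p ≡ suc ((J + 1) % 2) → Link l I J w p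
  top-link  : I ≡ suc l → J < 2 ^ l → 1 ≤ p → p < 2 ^ l → w ≡ (suc l , (J + p) mod2^ l) → Link l I J w p
  down-link : ∀ i → I ≡ suc l → J < 2 ^ l → i ≤ l → w ≡ (i , J) → p ≡ 2 ^ l + i → Link l I J w p
  up-link   : I ≤ l → J < 2 ^ l → w ≡ (suc l , J) → p ≡ portUp I J → Link l I J w p
  fwd-link  : I < l → J < 2 ^ l → w ≡ (suc I , π I J) → p ≡ 3 → Link l I J w p
  bwd-link  : ∀ i j → I ≡ suc i → i < l → j < 2 ^ l → J ≡ π i j → w ≡ (i , j) → p ≡ 2 → Link l I J w p

clique : ℕ → ℕ → List HalfEdge
clique l j = map (λ p → ((suc l , j) , (suc l , (j + p) mod2^ l) , p)) (map suc (upTo (2 ^ l ∸ 1)))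

spokes : ℕ → ℕ → ℕ → List HalfEdge
spokes l j i = ((suc l , j) , (i , j) , (2 ^ l) + i) ∷ ((i , j) , (suc l , j) , portUp i j) ∷ []

rungs : ℕ → ℕ → ℕ → List HalfEdge
rungs l j i = ((i , j) , (suc i , π i j) , 3) ∷ ((suc i , π i j) , (i , j) , 2) ∷ []

m<n∸1⇒1+m<n : ∀ n {m} → m < n ∸ 1 → suc m < n
m<n∸1⇒1+m<n (suc n) m<n = s≤s m<n

1+m<n⇒m<n∸1 : ∀ n {m} → suc m < n → m < n ∸ 1
1+m<n⇒m<n∸1 (suc n) (s≤s m<n) = m<n

Port⇒Link : ∀ l {I J w p} → Port l (I , J) w p → Link l I J w p
Port⇒Link l e∈ with ∈-++⁻ (rule1 l) e∈
... | inj₁ e∈₁ with ∈-map⁻ _ e∈₁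
...   | j , j∈ , refl = xor-link refl (∈-upTo⁻ j∈) refl refl
Port⇒Link l e∈ | inj₂ e∈′ with ∈-++⁻ (rule2 l) e∈′
... | inj₁ e∈₂ with find (∈-concatMap⁻ _ {xs = upTo (2 ^ l)} e∈₂)
...   | j , j∈ , e∈j with ∈-map⁻ _ e∈j
...     | _ , p∈ , refl with ∈-map⁻ suc p∈
...       | p , p∈′ , refl = top-link refl (∈-upTo⁻ j∈) (s≤s z≤n) (m<n∸1⇒1+m<n (2 ^ l) (∈-upTo⁻ p∈′)) refl
Port⇒Link l e∈ | inj₂ e∈′ | inj₂ e∈″ with ∈-++⁻ (rule3 l) e∈″
... | inj₁ e∈₃ with find (∈-concatMap⁻ _ {xs = upTo (2 ^ l)} e∈₃)
...   | j , j∈ , e∈j with find (∈-concatMap⁻ (spokes l j) {xs = upTo (suc l)} e∈j)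
...     | i , i∈ , here refl         = down-link i refl (∈-upTo⁻ j∈) (≤-pred (∈-upTo⁻ i∈)) refl refl
...     | i , i∈ , there (here refl) = up-link (≤-pred (∈-upTo⁻ i∈)) (∈-upTo⁻ j∈) refl refl
Port⇒Link l e∈ | inj₂ e∈′ | inj₂ e∈″ | inj₂ e∈₄ with find (∈-concatMap⁻ _ {xs = upTo (2 ^ l)} e∈₄)
...   | j , j∈ , e∈j with find (∈-concatMap⁻ (rungs l j) {xs = upTo l} e∈j)
...     | i , i∈ , here refl         = fwd-link (∈-upTo⁻ i∈) (∈-upTo⁻ j∈) refl refl
...     | i , i∈ , there (here refl) = bwd-link i j refl (∈-upTo⁻ i∈) (∈-upTo⁻ j∈) refl refl refl

Link⇒Port : ∀ l {I J w p} → Link l I J w p → Port l (I , J) w p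
Link⇒Port l (xor-link refl j< refl refl) = ∈-++⁺ˡ (∈-map⁺ _ (∈-upTo⁺ j<))
Link⇒Port l (top-link refl j< (s≤s z≤n) p< refl) =
  ∈-++⁺ʳ (rule1 l) (∈-++⁺ˡ (∈-concatMap⁺ _ {xs = upTo (2 ^ l)} (lose (∈-upTo⁺ j<)
    (∈-map⁺ _ (∈-map⁺ suc (∈-upTo⁺ (1+m<n⇒m<n∸1 (2 ^ l) p<)))))))
Link⇒Port l {J = J} (down-link i refl j< i≤l refl refl) =
  ∈-++⁺ʳ (rule1 l) (∈-++⁺ʳ (rule2 l) (∈-++⁺ˡ (∈-concatMap⁺ _ {xs = upTo (2 ^ l)} (lose (∈-upTo⁺ j<)
    (∈-concatMap⁺ (spokes l J) {xs = upTo (suc l)} (lose (∈-upTo⁺ (s≤s i≤l)) (here refl)))))))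
Link⇒Port l {J = J} (up-link I≤l j< refl refl) =
  ∈-++⁺ʳ (rule1 l) (∈-++⁺ʳ (rule2 l) (∈-++⁺ˡ (∈-concatMap⁺ _ {xs = upTo (2 ^ l)} (lose (∈-upTo⁺ j<)
    (∈-concatMap⁺ (spokes l J) {xs = upTo (suc l)} (lose (∈-upTo⁺ (s≤s I≤l)) (there (here refl))))))))
Link⇒Port l {J = J} (fwd-link I<l j< refl refl) =
  ∈-++⁺ʳ (rule1 l) (∈-++⁺ʳ (rule2 l) (∈-++⁺ʳ (rule3 l) (∈-concatMap⁺ _ {xs = upTo (2 ^ l)} (lose (∈-upTo⁺ j<)
    (∈-concatMap⁺ (rungs l J) {xs = upTo l} (lose (∈-upTo⁺ I<l) (here refl)))))))
Link⇒Port l (bwd-link i j refl i<l j< refl refl refl) =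
  ∈-++⁺ʳ (rule1 l) (∈-++⁺ʳ (rule2 l) (∈-++⁺ʳ (rule3 l) (∈-concatMap⁺ _ {xs = upTo (2 ^ l)} (lose (∈-upTo⁺ j<)
    (∈-concatMap⁺ (rungs l j) {xs = upTo l} (lose (∈-upTo⁺ i<l) (there (here refl))))))))

-- Degrees

count-pair : ∀ v e e′ → count v (e ∷ e′ ∷ []) ≡ 𝟙 (source e ≟N v) + 𝟙 (source e′ ≟N v)
count-pair v e e′ = trans (count-∷ v e (e′ ∷ []))
  (cong (𝟙 (source e ≟N v) +_) (trans (count-∷ v e′ []) (+-identityʳ _)))

-- The half-edges at a node of level I contributed by rules (1), (2), (3) and (4), respectively.
levelDegree : ℕ → ℕ → ℕ
levelDegree l I =
  𝟙 (0 ≟ I) + (𝟙 (suc l ≟ I) * (2 ^ l ∸ 1) + ((∑[ i < suc l ] (𝟙 (suc l ≟ I) + 𝟙 (i ≟ I)))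
                                              + (∑[ i < l ] (𝟙 (i ≟ I) + 𝟙 (suc i ≟ I)))))

module _ (l I J : ℕ) (J<2^l : J < 2 ^ l) where

  private
    v : Node
    v = (I , J)
    N = 2 ^ l

  count-rule1 : count v (rule1 l) ≡ 𝟙 (0 ≟ I)
  count-rule1 = begin
    count v (rule1 l)                    ≡⟨ count-map v _ id N ⟩
    ∑[ k < N ] 𝟙 ((0 , k) ≟N (I , J))   ≡⟨ ∑-cong N (λ k _ → 𝟙-≟N 0 k I J) ⟩
    ∑[ k < N ] 𝟙 (0 ≟ I) * 𝟙 (k ≟ J)    ≡⟨ ∑-𝟙-involution N id (𝟙 (0 ≟ I)) (λ _ → refl) J<2^l ⟩
    𝟙 (0 ≟ I)                            ∎
    where open ≡-Reasoning

  count-rule2 : count v (rule2 l) ≡ 𝟙 (suc l ≟ I) * (N ∸ 1)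
  count-rule2 = begin
    count v (rule2 l)
      ≡⟨ count-concatMap v (clique l) id N ⟩
    ∑[ k < N ] count v (clique l k)
      ≡⟨ ∑-cong N (λ k _ → row k) ⟩
    ∑[ k < N ] 𝟙 (suc l ≟ I) * (N ∸ 1) * 𝟙 (k ≟ J)
      ≡⟨ ∑-𝟙-involution N id (𝟙 (suc l ≟ I) * (N ∸ 1)) (λ _ → refl) J<2^l ⟩
    𝟙 (suc l ≟ I) * (N ∸ 1)
      ∎
    where
    open ≡-Reasoning
    row : ∀ k → count v (clique l k) ≡ 𝟙 (suc l ≟ I) * (N ∸ 1) * 𝟙 (k ≟ J)
    row k = begin
      count v (clique l k)
        ≡⟨ count-map-from v (suc l , k) _ (map suc (upTo (N ∸ 1))) (λ _ → refl) ⟩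
      𝟙 ((suc l , k) ≟N v) * length (map suc (upTo (N ∸ 1)))
        ≡⟨ cong₂ _*_ (𝟙-≟N (suc l) k I J) (trans (length-map suc (upTo (N ∸ 1))) (length-upTo (N ∸ 1))) ⟩
      𝟙 (suc l ≟ I) * 𝟙 (k ≟ J) * (N ∸ 1)
        ≡⟨ *-assoc (𝟙 (suc l ≟ I)) _ _ ⟩
      𝟙 (suc l ≟ I) * (𝟙 (k ≟ J) * (N ∸ 1))
        ≡⟨ cong (𝟙 (suc l ≟ I) *_) (*-comm (𝟙 (k ≟ J)) (N ∸ 1)) ⟩
      𝟙 (suc l ≟ I) * ((N ∸ 1) * 𝟙 (k ≟ J))
        ≡⟨ *-assoc (𝟙 (suc l ≟ I)) _ _ ⟨
      𝟙 (suc l ≟ I) * (N ∸ 1) * 𝟙 (k ≟ J)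
        ∎

  count-rule3 : count v (rule3 l) ≡ ∑[ i < suc l ] (𝟙 (suc l ≟ I) + 𝟙 (i ≟ I))
  count-rule3 = begin
    count v (rule3 l)
      ≡⟨ count-concatMap v _ id N ⟩
    ∑[ j < N ] count v (concatMap (spokes l j) (upTo (suc l)))
      ≡⟨ ∑-cong N (λ j _ → count-concatMap v (spokes l j) id (suc l)) ⟩
    ∑[ j < N ] ∑[ i < suc l ] count v (spokes l j i)
      ≡⟨ ∑-cong N (λ j _ → ∑-cong (suc l) (λ i _ → spoke j i)) ⟩
    ∑[ j < N ] ∑[ i < suc l ] (𝟙 (suc l ≟ I) + 𝟙 (i ≟ I)) * 𝟙 (j ≟ J)
      ≡⟨ ∑-comm N (suc l) (λ j i → (𝟙 (suc l ≟ I) + 𝟙 (i ≟ I)) * 𝟙 (j ≟ J)) ⟩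
    ∑[ i < suc l ] ∑[ j < N ] (𝟙 (suc l ≟ I) + 𝟙 (i ≟ I)) * 𝟙 (j ≟ J)
      ≡⟨ ∑-cong (suc l) (λ i _ → ∑-𝟙-involution N id (𝟙 (suc l ≟ I) + 𝟙 (i ≟ I)) (λ _ → refl) J<2^l) ⟩
    ∑[ i < suc l ] (𝟙 (suc l ≟ I) + 𝟙 (i ≟ I))
      ∎
    where
    open ≡-Reasoning
    spoke : ∀ j i → count v (spokes l j i) ≡ (𝟙 (suc l ≟ I) + 𝟙 (i ≟ I)) * 𝟙 (j ≟ J)
    spoke j i = begin
      count v (spokes l j i)
        ≡⟨ count-pair v ((suc l , j) , (i , j) , 2 ^ l + i) ((i , j) , (suc l , j) , portUp i j) ⟩
      𝟙 ((suc l , j) ≟N v) + 𝟙 ((i , j) ≟N v)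
        ≡⟨ cong₂ _+_ (𝟙-≟N (suc l) j I J) (𝟙-≟N i j I J) ⟩
      𝟙 (suc l ≟ I) * 𝟙 (j ≟ J) + 𝟙 (i ≟ I) * 𝟙 (j ≟ J)
        ≡⟨ *-distribʳ-+ (𝟙 (j ≟ J)) (𝟙 (suc l ≟ I)) _ ⟨
      (𝟙 (suc l ≟ I) + 𝟙 (i ≟ I)) * 𝟙 (j ≟ J)
        ∎

  count-rule4 : count v (rule4 l) ≡ ∑[ i < l ] (𝟙 (i ≟ I) + 𝟙 (suc i ≟ I))
  count-rule4 = begin
    count v (rule4 l)
      ≡⟨ count-concatMap v _ id N ⟩
    ∑[ j < N ] count v (concatMap (rungs l j) (upTo l))
      ≡⟨ ∑-cong N (λ j _ → count-concatMap v (rungs l j) id l) ⟩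
    ∑[ j < N ] ∑[ i < l ] count v (rungs l j i)
      ≡⟨ ∑-cong N (λ j _ → ∑-cong l (λ i _ → rung j i)) ⟩
    ∑[ j < N ] ∑[ i < l ] (𝟙 (i ≟ I) * 𝟙 (j ≟ J) + 𝟙 (suc i ≟ I) * 𝟙 (π i j ≟ J))
      ≡⟨ ∑-comm N l (λ j i → 𝟙 (i ≟ I) * 𝟙 (j ≟ J) + 𝟙 (suc i ≟ I) * 𝟙 (π i j ≟ J)) ⟩
    ∑[ i < l ] ∑[ j < N ] (𝟙 (i ≟ I) * 𝟙 (j ≟ J) + 𝟙 (suc i ≟ I) * 𝟙 (π i j ≟ J))
      ≡⟨ ∑-cong l (λ i _ → ∑-+ N (λ j → 𝟙 (i ≟ I) * 𝟙 (j ≟ J)) (λ j → 𝟙 (suc i ≟ I) * 𝟙 (π i j ≟ J))) ⟩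
    ∑[ i < l ] ((∑[ j < N ] 𝟙 (i ≟ I) * 𝟙 (j ≟ J)) + (∑[ j < N ] 𝟙 (suc i ≟ I) * 𝟙 (π i j ≟ J)))
      ≡⟨ ∑-cong l (λ i i<l → cong₂ _+_ (∑-𝟙-involution N id (𝟙 (i ≟ I)) (λ _ → refl) J<2^l)
                                        (∑-𝟙-involution N (π i) (𝟙 (suc i ≟ I)) (π-involutive i) (π-< i<l J<2^l))) ⟩
    ∑[ i < l ] (𝟙 (i ≟ I) + 𝟙 (suc i ≟ I))
      ∎
    where
    open ≡-Reasoning
    rung : ∀ j i → count v (rungs l j i) ≡ 𝟙 (i ≟ I) * 𝟙 (j ≟ J) + 𝟙 (suc i ≟ I) * 𝟙 (π i j ≟ J)
    rung j i = trans (count-pair v ((i , j) , (suc i , π i j) , 3) ((suc i , π i j) , (i , j) , 2))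
                     (cong₂ _+_ (𝟙-≟N i j I J) (𝟙-≟N (suc i) (π i j) I J))

  deg≡levelDegree : deg l (I , J) ≡ levelDegree l I
  deg≡levelDegree = begin
    deg l (I , J)
      ≡⟨ count-++ v (rule1 l) _ ⟩
    count v (rule1 l) + count v (rule2 l ++ rule3 l ++ rule4 l)
      ≡⟨ cong (count v (rule1 l) +_) (count-++ v (rule2 l) _) ⟩
    count v (rule1 l) + (count v (rule2 l) + count v (rule3 l ++ rule4 l))
      ≡⟨ cong (λ x → count v (rule1 l) + (count v (rule2 l) + x)) (count-++ v (rule3 l) _) ⟩
    count v (rule1 l) + (count v (rule2 l) + (count v (rule3 l) + count v (rule4 l)))
      ≡⟨ cong₂ _+_ count-rule1 (cong₂ _+_ count-rule2 (cong₂ _+_ count-rule3 count-rule4)) ⟩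
    levelDegree l I
      ∎
    where open ≡-Reasoning

levelDegree-0 : ∀ {l} → 1 ≤ l → levelDegree l 0 ≡ 3
levelDegree-0 {l} 1≤l = cong₂ (λ a b → 1 + (a + b))
  (∑-𝟙-< (suc l) z<s)
  (trans (∑-cong l (λ i _ → +-identityʳ (𝟙 (i ≟ 0)))) (∑-𝟙-< l 1≤l))

∑-𝟙-suc : ∀ n I → ∑[ k < n ] 𝟙 (suc k ≟ suc I) ≡ ∑[ k < n ] 𝟙 (k ≟ I)
∑-𝟙-suc n I = ∑-cong n (λ k _ → 𝟙-suc k I)

levelDegree-suc : ∀ {l i} → suc i ≤ l → levelDegree l (suc i) ≡ 2 + (∑[ k < l ] 𝟙 (k ≟ suc i))
levelDegree-suc {l} {i} 1+i≤l = begin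
  levelDegree l (suc i)
    ≡⟨ cong (λ a → a * (2 ^ l ∸ 1) + ((∑[ k < suc l ] (a + 𝟙 (k ≟ suc i)))
                                     + (∑[ k < l ] (𝟙 (k ≟ suc i) + 𝟙 (suc k ≟ suc i))))) top≢ ⟩
  (∑[ k < suc l ] 𝟙 (k ≟ suc i)) + (∑[ k < l ] (𝟙 (k ≟ suc i) + 𝟙 (suc k ≟ suc i)))
    ≡⟨ cong ((∑[ k < suc l ] 𝟙 (k ≟ suc i)) +_) (∑-+ l (λ k → 𝟙 (k ≟ suc i)) (λ k → 𝟙 (suc k ≟ suc i))) ⟩
  (∑[ k < suc l ] 𝟙 (k ≟ suc i)) + ((∑[ k < l ] 𝟙 (k ≟ suc i)) + (∑[ k < l ] 𝟙 (suc k ≟ suc i)))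
    ≡⟨ cong₂ (λ a b → a + ((∑[ k < l ] 𝟙 (k ≟ suc i)) + b))
             (∑-𝟙-< (suc l) (s≤s 1+i≤l)) (trans (∑-𝟙-suc l i) (∑-𝟙-< l 1+i≤l)) ⟩
  1 + ((∑[ k < l ] 𝟙 (k ≟ suc i)) + 1)
    ≡⟨ cong suc (+-comm (∑[ k < l ] 𝟙 (k ≟ suc i)) 1) ⟩
  2 + (∑[ k < l ] 𝟙 (k ≟ suc i)) ∎
  where
  open ≡-Reasoning
  top≢ : 𝟙 (suc l ≟ suc i) ≡ 0
  top≢ = 𝟙-no (suc l ≟ suc i) (λ l≡i → <-irrefl (sym l≡i) (s≤s 1+i≤l))

levelDegree-inner : ∀ {l i} → suc i < l → levelDegree l (suc i) ≡ 3
levelDegree-inner {l} {i} 1+i<l = trans (levelDegree-suc {i = i} (<⇒≤ 1+i<l)) (cong (2 +_) (∑-𝟙-< l 1+i<l))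

levelDegree-last : ∀ i → levelDegree (suc i) (suc i) ≡ 2
levelDegree-last i = trans (levelDegree-suc {i = i} ≤-refl) (cong (2 +_) (∑-𝟙-≥ (suc i) ≤-refl))

levelDegree-top : ∀ l → levelDegree l (suc l) ≡ 2 ^ l + l
levelDegree-top l = begin
  levelDegree l (suc l)
    ≡⟨ cong (λ a → a * (N ∸ 1) + ((∑[ k < suc l ] (a + 𝟙 (k ≟ suc l)))
                                 + (∑[ k < l ] (𝟙 (k ≟ suc l) + 𝟙 (suc k ≟ suc l))))) top≡ ⟩
  1 * (N ∸ 1) + ((∑[ k < suc l ] suc (𝟙 (k ≟ suc l))) + (∑[ k < l ] (𝟙 (k ≟ suc l) + 𝟙 (suc k ≟ suc l))))
    ≡⟨ cong₂ _+_ (*-identityˡ (N ∸ 1)) (cong₂ _+_ spokes-sum rungs-sum) ⟩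
  (N ∸ 1) + (suc l + 0)
    ≡⟨ cong ((N ∸ 1) +_) (+-identityʳ (suc l)) ⟩
  (N ∸ 1) + suc l
    ≡⟨ +-suc (N ∸ 1) l ⟩
  suc (N ∸ 1) + l
    ≡⟨ cong (_+ l) (suc-pred N {{m^n≢0 2 l}}) ⟩
  N + l ∎
  where
  open ≡-Reasoning
  N = 2 ^ l
  top≡ : 𝟙 (suc l ≟ suc l) ≡ 1
  top≡ = 𝟙-yes (suc l ≟ suc l) refl
  spokes-sum : ∑[ k < suc l ] suc (𝟙 (k ≟ suc l)) ≡ suc l
  spokes-sum = trans (∑-+ (suc l) (λ _ → 1) (λ k → 𝟙 (k ≟ suc l)))
                     (trans (cong₂ _+_ (∑-one (suc l)) (∑-𝟙-≥ (suc l) ≤-refl)) (+-identityʳ (suc l)))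
  rungs-sum : ∑[ k < l ] (𝟙 (k ≟ suc l) + 𝟙 (suc k ≟ suc l)) ≡ 0
  rungs-sum = trans (∑-+ l (λ k → 𝟙 (k ≟ suc l)) (λ k → 𝟙 (suc k ≟ suc l)))
                    (cong₂ _+_ (∑-𝟙-≥ l (n≤1+n l)) (trans (∑-𝟙-suc l l) (∑-𝟙-≥ l ≤-refl)))

-- Neighbours and return ports

1∸r≢r : ∀ {r} → r < 2 → 1 ∸ r ≢ r
1∸r≢r {zero}        _ ()
1∸r≢r {suc zero}    _ ()
1∸r≢r {suc (suc r)} (s≤s (s≤s ()))

xor-port≢up-port : ∀ {J₁ J₂} → J₁ % 2 ≡ J₂ % 2 → suc ((J₁ + 1) % 2) ≢ portUp 0 J₂
xor-port≢up-port {J₁} par p≡ =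
  1∸r≢r (m%n<n J₁ 2) (trans (sym ([j+1]%2≡1∸j%2 J₁)) (trans (suc-injective p≡) (sym par)))

xor-port≤2 : ∀ J → suc ((J + 1) % 2) ≤ 2
xor-port≤2 J = s≤s (≤-pred (m%n<n (J + 1) 2))

portUp≤2 : ∀ i J → portUp i J ≤ 2
portUp≤2 zero    J = s≤s (≤-pred (m%n<n J 2))
portUp≤2 (suc i) J = s≤s z≤n

portUp-%2 : ∀ i {J₁ J₂} → J₁ % 2 ≡ J₂ % 2 → portUp i J₁ ≡ portUp i J₂
portUp-%2 zero    par = cong suc par
portUp-%2 (suc i) par = refl

3≰2 : ∀ {p} → p ≡ 3 → p ≰ 2
3≰2 refl = 1+n≰n

xor-target : ∀ {l J₁ J₂ w} → J₁ % 2 ≡ J₂ % 2 → Link l 0 J₂ w (suc ((J₁ + 1) % 2)) → w ≡ (0 , xor1 J₂)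
xor-target par (xor-link _ _ w≡ _)         = w≡
xor-target par (top-link () _ _ _ _)
xor-target par (down-link _ () _ _ _ _)
xor-target {J₁ = J₁} {J₂} par (up-link _ _ _ p≡) = ⊥-elim (xor-port≢up-port {J₁} {J₂} par p≡)
xor-target {J₁ = J₁} par (fwd-link _ _ _ p≡) = ⊥-elim (3≰2 p≡ (xor-port≤2 J₁))
xor-target par (bwd-link _ _ () _ _ _ _ _)

top-target : ∀ {l J w p} → p < 2 ^ l → Link l (suc l) J w p → w ≡ (suc l , (J + p) mod2^ l)
top-target p<   (xor-link () _ _ _)
top-target p<   (top-link _ _ _ _ w≡)            = w≡
top-target p<   (down-link i _ _ _ _ refl)       = ⊥-elim (m+n≮m _ i p<)
top-target p<   (up-link l<l _ _ _)              = ⊥-elim (1+n≰n l<l)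
top-target p<   (fwd-link l<l _ _ _)             = ⊥-elim (1+n≰n (<⇒≤ l<l))
top-target p<   (bwd-link _ _ refl l<l _ _ _ _)  = ⊥-elim (1+n≰n l<l)

down-target : ∀ {l J w i} → Link l (suc l) J w (2 ^ l + i) → w ≡ (i , J)
down-target (xor-link () _ _ _)
down-target (top-link _ _ _ p< _)                 = ⊥-elim (m+n≮m _ _ p<)
down-target {l} (down-link i′ _ _ _ w≡ p≡)        = trans w≡ (cong (_, _) (sym (+-cancelˡ-≡ (2 ^ l) _ _ p≡)))
down-target (up-link l<l _ _ _)                   = ⊥-elim (1+n≰n l<l)
down-target (fwd-link l<l _ _ _)                  = ⊥-elim (1+n≰n (<⇒≤ l<l))
down-target (bwd-link _ _ refl l<l _ _ _ _)       = ⊥-elim (1+n≰n l<l)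

up-target : ∀ {l I J₁ J₂ w} → I ≤ l → J₁ % 2 ≡ J₂ % 2 → Link l I J₂ w (portUp I J₁) → w ≡ (suc l , J₂)
up-target {J₁ = J₁} {J₂} _ par (xor-link refl _ _ p≡) = ⊥-elim (xor-port≢up-port {J₂} {J₁} (sym par) (sym p≡))
up-target I≤l par (top-link refl _ _ _ _)         = ⊥-elim (1+n≰n I≤l)
up-target I≤l par (down-link _ refl _ _ _ _)      = ⊥-elim (1+n≰n I≤l)
up-target I≤l par (up-link _ _ w≡ _)              = w≡
up-target {I = I} {J₁} I≤l par (fwd-link _ _ _ p≡) = ⊥-elim (3≰2 p≡ (portUp≤2 I J₁))
up-target I≤l par (bwd-link _ _ refl _ _ _ _ ())

fwd-target : ∀ {l I J w} → I < l → Link l I J w 3 → w ≡ (suc I , π I J)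
fwd-target {J = J} I<l (xor-link _ _ _ p≡)      = ⊥-elim (3≰2 (sym p≡) (xor-port≤2 J))
fwd-target I<l (top-link refl _ _ _ _)            = ⊥-elim (1+n≰n (<⇒≤ I<l))
fwd-target I<l (down-link _ refl _ _ _ _)         = ⊥-elim (1+n≰n (<⇒≤ I<l))
fwd-target {I = I} {J} I<l (up-link _ _ _ p≡)   = ⊥-elim (3≰2 (sym p≡) (portUp≤2 I J))
fwd-target I<l (fwd-link _ _ w≡ _)                = w≡
fwd-target I<l (bwd-link _ _ _ _ _ _ _ ())

bwd-target : ∀ {l i J w} → i < l → Link l (suc i) J w 2 → w ≡ (i , π i J)
bwd-target i<l (xor-link () _ _ _)
bwd-target i<l (top-link refl _ _ _ _)            = ⊥-elim (1+n≰n i<l)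
bwd-target i<l (down-link _ refl _ _ _ _)         = ⊥-elim (1+n≰n i<l)
bwd-target i<l (up-link _ _ _ ())
bwd-target i<l (fwd-link _ _ _ ())
bwd-target i<l (bwd-link i j refl _ _ refl refl _) = cong (i ,_) (sym (π-involutive i j))

ReturnPort : ℕ → Node → Node → ℕ → Set
ReturnPort l w v q = Port l w v q × (∀ q′ → Port l w v q′ → q′ ≡ q)

xor-return : ∀ {l J} → 1 ≤ l → J < 2 ^ l → ReturnPort l (0 , xor1 J) (0 , J) (suc ((xor1 J + 1) % 2))
xor-return {l} {J} 1≤l J< =
  Link⇒Port l (xor-link refl (xor1-< 1≤l J<) (cong (0 ,_) (sym (xor1-involutive J))) refl) ,
  λ q → unique ∘ Port⇒Link l
  where
  unique : ∀ {q} → Link l 0 (xor1 J) (0 , J) q → q ≡ suc ((xor1 J + 1) % 2)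
  unique (xor-link _ _ _ q≡)       = q≡
  unique (top-link () _ _ _ _)
  unique (down-link _ () _ _ _ _)
  unique (up-link _ _ () _)
  unique (fwd-link _ _ () _)
  unique (bwd-link _ _ () _ _ _ _ _)

top-return : ∀ {l J p} → J < 2 ^ l → 1 ≤ p → p < 2 ^ l →
             ReturnPort l (suc l , (J + p) mod2^ l) (suc l , J) (2 ^ l ∸ p)
top-return {l} {J} {p} J< 1≤p p< =
  Link⇒Port l (top-link refl (m%n<n (J + p) (2 ^ l) {{m^n≢0 2 l}}) (m<n⇒0<n∸m p<)
                        (∸-monoʳ-< 1≤p (<⇒≤ p<))
                        (cong (suc l ,_) (sym (Rotation.rotate-back (2 ^ l) {{m^n≢0 2 l}} J< (<⇒≤ p<))))) ,
  λ q → unique ∘ Port⇒Link l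
  where
  unique : ∀ {q} → Link l (suc l) ((J + p) mod2^ l) (suc l , J) q → q ≡ 2 ^ l ∸ p
  unique (xor-link () _ _ _)
  unique (top-link _ _ _ q< w≡) =
    Rotation.rotate-back-unique (2 ^ l) {{m^n≢0 2 l}} J< 1≤p (<⇒≤ p<) q< (sym (cong proj₂ w≡))
  unique (down-link i _ _ i≤l w≡ _)         = ⊥-elim (1+n≰n (subst (_≤ l) (sym (cong proj₁ w≡)) i≤l))
  unique (up-link l<l _ _ _)                = ⊥-elim (1+n≰n l<l)
  unique (fwd-link l<l _ _ _)               = ⊥-elim (1+n≰n (<⇒≤ l<l))
  unique (bwd-link _ _ refl l<l _ _ _ _)    = ⊥-elim (1+n≰n l<l)

down-return : ∀ {l i J} → i ≤ l → J < 2 ^ l → ReturnPort l (i , J) (suc l , J) (portUp i J)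
down-return {l} {i} {J} i≤l J< = Link⇒Port l (up-link i≤l J< refl refl) , λ q → unique ∘ Port⇒Link l
  where
  unique : ∀ {q} → Link l i J (suc l , J) q → q ≡ portUp i J
  unique (xor-link _ _ () _)
  unique (top-link refl _ _ _ _)            = ⊥-elim (1+n≰n i≤l)
  unique (down-link _ refl _ _ _ _)         = ⊥-elim (1+n≰n i≤l)
  unique (up-link _ _ _ q≡)                 = q≡
  unique (fwd-link i<l _ w≡ _)              = ⊥-elim (<-irrefl (sym (suc-injective (cong proj₁ w≡))) i<l)
  unique (bwd-link _ _ _ i′<l _ _ w≡ _)     = ⊥-elim (1+n≰n (<⇒≤ (subst (_< l) (sym (cong proj₁ w≡)) i′<l)))

up-return : ∀ {l I J} → I ≤ l → J < 2 ^ l → ReturnPort l (suc l , J) (I , J) (2 ^ l + I)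
up-return {l} {I} {J} I≤l J< = Link⇒Port l (down-link I refl J< I≤l refl refl) , λ q → unique ∘ Port⇒Link l
  where
  unique : ∀ {q} → Link l (suc l) J (I , J) q → q ≡ 2 ^ l + I
  unique (xor-link () _ _ _)
  unique (top-link _ _ _ _ w≡)              = ⊥-elim (1+n≰n (subst (_≤ l) (cong proj₁ w≡) I≤l))
  unique (down-link _ _ _ _ refl q≡)        = q≡
  unique (up-link l<l _ _ _)                = ⊥-elim (1+n≰n l<l)
  unique (fwd-link l<l _ _ _)               = ⊥-elim (1+n≰n (<⇒≤ l<l))
  unique (bwd-link _ _ refl l<l _ _ _ _)    = ⊥-elim (1+n≰n l<l)

fwd-return : ∀ {l I J} → I < l → J < 2 ^ l → ReturnPort l (suc I , π I J) (I , J) 2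
fwd-return {l} {I} {J} I<l J< =
  Link⇒Port l (bwd-link I J refl I<l J< refl refl refl) , λ q → unique ∘ Port⇒Link l
  where
  unique : ∀ {q} → Link l (suc I) (π I J) (I , J) q → q ≡ 2
  unique (xor-link () _ _ _)
  unique (top-link refl _ _ _ _)            = ⊥-elim (1+n≰n I<l)
  unique (down-link _ refl _ _ _ _)         = ⊥-elim (1+n≰n I<l)
  unique (up-link 1+I≤l _ w≡ _)             = ⊥-elim (1+n≰n (<⇒≤ (subst (λ x → suc x ≤ l) (cong proj₁ w≡) 1+I≤l)))
  unique (fwd-link _ _ w≡ _)                = ⊥-elim (1+n≰n (subst (_≤ suc I) (cong proj₁ w≡) (n≤1+n I)))
  unique (bwd-link _ _ _ _ _ _ _ q≡)        = q≡

bwd-return : ∀ {l i J} → i < l → J < 2 ^ l → ReturnPort l (i , π i J) (suc i , J) 3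
bwd-return {l} {i} {J} i<l J< =
  Link⇒Port l (fwd-link i<l (π-< i<l J<) (cong (suc i ,_) (sym (π-involutive i J))) refl) ,
  λ q → unique ∘ Port⇒Link l
  where
  unique : ∀ {q} → Link l i (π i J) (suc i , J) q → q ≡ 3
  unique (xor-link _ _ () _)
  unique (top-link refl _ _ _ _)            = ⊥-elim (1+n≰n (<⇒≤ i<l))
  unique (down-link _ refl _ _ _ _)         = ⊥-elim (1+n≰n (<⇒≤ i<l))
  unique (up-link _ _ w≡ _)                 = ⊥-elim (<-irrefl (suc-injective (cong proj₁ w≡)) i<l)
  unique (fwd-link _ _ _ q≡)                = q≡
  unique (bwd-link i′ _ refl _ _ _ w≡ _)    = ⊥-elim (1+n≰n (subst (suc i′ ≤_) (cong proj₁ w≡) (n≤1+n (suc i′))))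

Compatible : ℕ → ℕ → ℕ → ℕ → Node → Node → Set
Compatible l I J₁ J₂ w₁ w₂ =
  (level w₁ ≡ level w₂)
  × (δ l J₁ J₂ ≤ δ l (column w₁) (column w₂) + 1)
  × (∃ λ q → Port l w₁ (I , J₁) q)
  × (∃ λ q → Port l w₂ (I , J₂) q)
  × (∀ q₁ q₂ → Port l w₁ (I , J₁) q₁ → Port l w₂ (I , J₂) q₂ → q₁ ≡ q₂)

compatible : ∀ l {I J₁ J₂ w₁ w₂ q₁ q₂} → level w₁ ≡ level w₂ →
             (∀ k → suc k ≤ l → Agree (suc k) J₁ J₂ → Agree k (column w₁) (column w₂)) →
             ReturnPort l w₁ (I , J₁) q₁ → ReturnPort l w₂ (I , J₂) q₂ → q₁ ≡ q₂ →
             Compatible l I J₁ J₂ w₁ w₂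
compatible l same-level agree (back₁ , unique₁) (back₂ , unique₂) q₁≡q₂ =
  same-level , δ≤δ+1 l agree , (_ , back₁) , (_ , back₂) ,
  λ q q′ port port′ → trans (unique₁ q port) (trans q₁≡q₂ (sym (unique₂ q′ port′)))

next-compatible : ∀ {l I J₁ J₂ w₁ w₂ p} → 1 ≤ l → J₁ < 2 ^ l → J₂ < 2 ^ l → J₁ % 2 ≡ J₂ % 2 →
                  Link l I J₁ w₁ p → Link l I J₂ w₂ p → Compatible l I J₁ J₂ w₁ w₂
next-compatible {l} {J₁ = J₁} {J₂} 1≤l J₁< J₂< par link₁@(xor-link refl _ _ refl) link₂
  with refl ← xor-target {J₁ = J₁} refl link₁ | refl ← xor-target {J₁ = J₁} par link₂ =
  compatible l refl (λ k _ → Agree-weaken k ∘ xor1-Agree k) (xor-return 1≤l J₁<) (xor-return 1≤l J₂<)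
    (cong suc (trans ([j+1]%2≡1∸j%2 (xor1 J₁))
                     (trans (cong (1 ∸_) xor-par) (sym ([j+1]%2≡1∸j%2 (xor1 J₂))))))
  where
  xor-par : xor1 J₁ % 2 ≡ xor1 J₂ % 2
  xor-par with x≡ ∷ [] ← xor1-Agree 0 {J₁} {J₂} (par ∷ []) = x≡
next-compatible {l} _ J₁< J₂< _ link₁@(top-link refl _ 1≤p p< _) link₂
  with refl ← top-target p< link₁ | refl ← top-target p< link₂ =
  compatible l refl (λ k k<l → +-mod2^-Agree _ k<l) (top-return J₁< 1≤p p<) (top-return J₂< 1≤p p<) refl
next-compatible {l} _ J₁< J₂< par link₁@(down-link i refl _ i≤l _ refl) link₂
  with refl ← down-target link₁ | refl ← down-target link₂ =
  compatible l refl (λ k _ → Agree-weaken k) (down-return i≤l J₁<) (down-return i≤l J₂<) (portUp-%2 i par)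
next-compatible {l} _ J₁< J₂< par link₁@(up-link I≤l _ _ refl) link₂
  with refl ← up-target I≤l refl link₁ | refl ← up-target I≤l par link₂ =
  compatible l refl (λ k _ → Agree-weaken k) (up-return I≤l J₁<) (up-return I≤l J₂<) refl
next-compatible {l} {I} _ J₁< J₂< _ link₁@(fwd-link I<l _ _ refl) link₂
  with refl ← fwd-target I<l link₁ | refl ← fwd-target I<l link₂ =
  compatible l refl (λ k _ → π-Agree I k) (fwd-return I<l J₁<) (fwd-return I<l J₂<) refl
next-compatible {l} _ J₁< J₂< _ link₁@(bwd-link i _ refl i<l _ _ _ refl) link₂
  with refl ← bwd-target i<l link₁ | refl ← bwd-target i<l link₂ =
  compatible l refl (λ k _ → π-Agree i k) (bwd-return i<l J₁<) (bwd-return i<l J₂<) refl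

-- Existence of neighbours

p≡1+r⊎p≡2∸r : ∀ {p r} → 1 ≤ p → p ≤ 2 → r < 2 → p ≡ suc r ⊎ p ≡ suc (1 ∸ r)
p≡1+r⊎p≡2∸r {1} {0} _ _ _ = inj₁ refl
p≡1+r⊎p≡2∸r {1} {1} _ _ _ = inj₂ refl
p≡1+r⊎p≡2∸r {2} {0} _ _ _ = inj₂ refl
p≡1+r⊎p≡2∸r {2} {1} _ _ _ = inj₁ refl
p≡1+r⊎p≡2∸r {suc (suc (suc _))} _ (s≤s (s≤s ())) _
p≡1+r⊎p≡2∸r {r = suc (suc _)}   _ _ (s≤s (s≤s ()))

level-zero-port : ∀ {l J p} → 1 ≤ l → J < 2 ^ l → 1 ≤ p → p ≤ 3 → ∃ λ w → Link l 0 J w p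
level-zero-port {J = J} 1≤l J< 1≤p p≤3 with m≤n⇒m<n∨m≡n p≤3
... | inj₂ refl = _ , fwd-link 1≤l J< refl refl
... | inj₁ p<3 with p≡1+r⊎p≡2∸r 1≤p (≤-pred p<3) (m%n<n J 2)
...   | inj₁ p≡up  = _ , up-link z≤n J< refl p≡up
...   | inj₂ p≡xor = _ , xor-link refl J< refl (trans p≡xor (cong suc (sym ([j+1]%2≡1∸j%2 J))))

middle-port : ∀ {l i J p} → suc i ≤ l → J < 2 ^ l → 1 ≤ p → p ≤ 2 → ∃ λ w → Link l (suc i) J w p
middle-port {i = i} {J} 1+i≤l J< 1≤p p≤2 with m≤n⇒m<n∨m≡n p≤2
... | inj₂ refl      = _ , bwd-link i (π i J) refl 1+i≤l (π-< 1+i≤l J<) (sym (π-involutive i J)) refl refl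
... | inj₁ (s≤s p≤1) = _ , up-link 1+i≤l J< refl (≤-antisym p≤1 1≤p)

inner-port : ∀ {l i J p} → suc i < l → J < 2 ^ l → 1 ≤ p → p ≤ 3 → ∃ λ w → Link l (suc i) J w p
inner-port 1+i<l J< 1≤p p≤3 with m≤n⇒m<n∨m≡n p≤3
... | inj₂ refl = _ , fwd-link 1+i<l J< refl refl
... | inj₁ p<3  = middle-port (<⇒≤ 1+i<l) J< 1≤p (≤-pred p<3)

top-port : ∀ {l J p} → J < 2 ^ l → 1 ≤ p → p ≤ 2 ^ l + l → ∃ λ w → Link l (suc l) J w p
top-port {l} {J} {p} J< 1≤p p≤ with p <? 2 ^ l
... | yes p<  = _ , top-link refl J< 1≤p p< refl
... | no  p≮  = _ , down-link (p ∸ 2 ^ l) refl J< (m≤n+o⇒m∸n≤o p (2 ^ l) p≤) refl (sym (m+[n∸m]≡n (≮⇒≥ p≮)))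

port-exists : ∀ {l I J p} → 1 ≤ l → I ≤ suc l → J < 2 ^ l → 1 ≤ p → p ≤ levelDegree l I →
              ∃ λ w → Link l I J w p
port-exists {I = zero} {p = p} 1≤l _ J< 1≤p p≤ =
  level-zero-port 1≤l J< 1≤p (subst (p ≤_) (levelDegree-0 1≤l) p≤)
port-exists {l} {suc i} {p = p} _ 1+i≤1+l J< 1≤p p≤ with <-cmp (suc i) l
... | tri< 1+i<l _ _ = inner-port 1+i<l J< 1≤p (subst (p ≤_) (levelDegree-inner 1+i<l) p≤)
... | tri≈ _ refl _  = middle-port ≤-refl J< 1≤p (subst (p ≤_) (levelDegree-last i) p≤)
... | tri> _ _ l<1+i with refl ← ≤-antisym (≤-pred 1+i≤1+l) (≤-pred l<1+i) =
  top-port J< 1≤p (subst (p ≤_) (levelDegree-top l) p≤)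

lemma3p2 : (l : ℕ) → 1 ≤ l → (i j₁ j₂ : ℕ) → i ≤ suc l → j₁ < 2 ^ l → j₂ < 2 ^ l →
    0 < δ l j₁ j₂ →
    (deg l (i , j₁) ≡ deg l (i , j₂))
    × (∀ p → 1 ≤ p → p ≤ deg l (i , j₁) →
         (∃ λ w → Next l (i , j₁) p w)
         × (∃ λ w → Next l (i , j₂) p w)
         × (∀ w₁ w₂ → Next l (i , j₁) p w₁ → Next l (i , j₂) p w₂ →
              (level w₁ ≡ level w₂)
              × (δ l j₁ j₂ ≤ δ l (column w₁) (column w₂) + 1)
              × (∃ λ q → Port l w₁ (i , j₁) q)
              × (∃ λ q → Port l w₂ (i , j₂) q)
              × (∀ q₁ q₂ → Port l w₁ (i , j₁) q₁ → Port l w₂ (i , j₂) q₂ → q₁ ≡ q₂)))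
lemma3p2 l 1≤l i j₁ j₂ i≤1+l j₁< j₂< 0<δ =
  trans (deg≡levelDegree l i j₁ j₁<) (sym (deg≡levelDegree l i j₂ j₂<)) ,
  λ p 1≤p p≤deg →
    let p≤ = subst (p ≤_) (deg≡levelDegree l i j₁ j₁<) p≤deg
        (u₁ , link₁) = port-exists 1≤l i≤1+l j₁< 1≤p p≤
        (u₂ , link₂) = port-exists 1≤l i≤1+l j₂< 1≤p p≤
    in (u₁ , Link⇒Port l link₁) , (u₂ , Link⇒Port l link₂) ,
       λ w₁ w₂ next₁ next₂ →
         next-compatible 1≤l j₁< j₂< (0<δ⇒%2≡ l 0<δ) (Port⇒Link l next₁) (Port⇒Link l next₂)
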